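{- Let $s$ be a positive integer. Define integers $a_s(n)$ by $\sum_{n=0}^\infty a_s(n)q^n=\Delta(z)^{\frac{9^s-1}{8}}$, where $\Delta(z)=q\prod_{n\ge1}(1-q^n)^{24}$, and define integers $r_s(j)$ by $1+\sum_{j=1}^\infty r_s(j)q^{3\cdot 9^s j}=\prod_{n=1}^\infty(1-q^{3\cdot 9^s n})$. Then for every nonnegative integer $n$, \[ a_s(n)\equiv p\left(\frac{n-\frac{9^s-1}{8}}{3}\right)+\sum_{j=1}^\infty r_s(j)\,p\left(\frac{n-\frac{9^s-1}{8}}{3}-9^sj\right)\pmod 3. \]
   Context: $p(n)$ denotes the partition function, and by convention $p(x)=0$ whenever $x$ is not a nonnegative integer. Here $q=e^{2\pi i z}$ and identities are between formal $q$-series. -}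

module Defs where

open import Data.Nat using (ℕ; zero; suc; _∸_; _^_) renaming (_+_ to _+ℕ_; _*_ to _*ℕ_)
open import Data.Nat.DivMod using (_/_)
open import Data.Integer using (ℤ; +_; _+_; _-_; _*_; -_; 0ℤ; 1ℤ; _≤?_) renaming (∣_∣ to abs)
import Data.Integer.DivMod as ℤDM
open import Data.Integer.Divisibility using () renaming (_∣_ to _∣ℤ_)
open import Data.Bool using (if_then_else_)
open import Relation.Nullary using (does)
import Data.Nat as ℕ

Series : Set
Series = ℕ → ℤ

sumTo : ℕ → (ℕ → ℤ) → ℤ
sumTo zero    f = f 0
sumTo (suc n) f = sumTo n f + f (suc n)

sumFrom1 : ℕ → (ℕ → ℤ) → ℤ
sumFrom1 zero    f = 0ℤ
sumFrom1 (suc n) f = sumFrom1 n f + f (suc n)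

_⊛_ : Series → Series → Series
(f ⊛ g) n = sumTo n (λ i → f i * g (n ∸ i))

oneS : Series
oneS i = if does (i ℕ.≟ 0) then 1ℤ else 0ℤ

qPow : ℕ → Series
qPow k i = if does (i ℕ.≟ k) then 1ℤ else 0ℤ

oneMinusQ : ℕ → Series
oneMinusQ k i = oneS i - qPow k i

powS : Series → ℕ → Series
powS f zero    = oneS
powS f (suc e) = f ⊛ powS f e

prodTrunc : ℕ → ℕ → ℕ → Series
prodTrunc d e zero    = oneS
prodTrunc d e (suc M) = prodTrunc d e M ⊛ powS (oneMinusQ (d *ℕ suc M)) e

-- Coefficient of q^N in the infinite product ∏_{m≥1} (1 - q^{d m})^e  (d ≥ 1).
-- Factors with m > N are ≡ 1 mod q^{N+1}, so truncating at m ≤ N is exact.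
prodCoeff : ℕ → ℕ → ℕ → ℤ
prodCoeff d e N = prodTrunc d e N N

-- Δ(z)^k = q^k ∏ (1-q^n)^{24k}; coefficient of q^n.
deltaPowCoeff : ℕ → ℕ → ℤ
deltaPowCoeff k n = if does (k ℕ.≤? n) then prodCoeff 1 (24 *ℕ k) (n ∸ k) else 0ℤ

kS : ℕ → ℕ
kS s = (9 ^ s ∸ 1) / 8

a : ℕ → ℕ → ℤ
a s n = deltaPowCoeff (kS s) n

r : ℕ → ℕ → ℤ
r s j = prodCoeff (3 *ℕ 9 ^ s) 1 (3 *ℕ 9 ^ s *ℕ j)

-- number of partitions of n into parts of size ≤ k
partsLE : ℕ → ℕ → ℕ
partsLE n zero    = if does (n ℕ.≟ 0) then 1 else 0
partsLE n (suc k) = go n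
  where
  go : ℕ → ℕ
  go zero    = partsLE n k
  go (suc J) = go J +ℕ (if does (suc J *ℕ suc k ℕ.≤? n) then partsLE (n ∸ suc J *ℕ suc k) k else 0)

p : ℕ → ℕ
p n = partsLE n n

pℤ : ℤ → ℤ
pℤ x = if does (0ℤ ≤? x) then + p (abs x) else 0ℤ

-- p(m/3) for an integer m: zero unless m/3 is a nonnegative integer
pThird : ℤ → ℤ
pThird m = if does (ℕ._≟_ (ℤDM._%_ m (+ 3)) 0) then pℤ (ℤDM._/_ m (+ 3)) else 0ℤ

_≡₃_ : ℤ → ℤ → Set
x ≡₃ y = (+ 3) ∣ℤ (x - y)

open import Relation.Binary.PropositionalEquality using (_≡_; refl)
private
  t1 : p 5 ≡ 7
  t1 = refl
  t2 : kS 2 ≡ 10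
  t2 = refl
  t3 : prodCoeff 1 24 2 ≡ + 252
  t3 = refl
  t4 : pThird (+ 6) ≡ + 2
  t4 = refl
  t5 : pThird (+ 7) ≡ 0ℤ
  t5 = refl
  t6 : pThird (- (+ 3)) ≡ 0ℤ
  t6 = refl
  t7 : prodCoeff 2 1 2 ≡ - (+ 1)
  t7 = refl
  t8 : prodCoeff 2 1 3 ≡ 0ℤ
  t8 = refl

-- With k = (9^s - 1)/8 we have 24k + 3 = 3^(2s+1), so
--   Δ^k · ∏(1 - q^(3n)) = q^k ∏(1 - q^n)^(24k+3) ≡ q^k ∏(1 - q^(3^(2s+1) n))  (mod 3),
-- because (1 - x)^3 ≡ 1 - x^3 (mod 3). Multiplying by 1/∏(1 - q^(3n)) = Σ p(m) q^(3m) (Euler)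
-- and reading off the coefficient of q^n gives the congruence, the r_s(j) being the
-- coefficients of ∏(1 - q^(3·9^s n)).
module Submission where

open import Defs
open import Data.Nat using (ℕ; _≤_; _^_) renaming (_*_ to _*ℕ_)
open import Data.Integer using (ℤ; +_; _+_; _-_; _*_)

open import Data.Bool using (true; false; if_then_else_)
open import Data.Bool.Properties using (if-float; if-eta)
open import Data.Empty using (⊥-elim)
open import Data.Integer using (-[1+_]; -_; 0ℤ)
import Data.Integer.DivMod as ℤ
open import Data.Integer.Divisibility.Signed as ℤ∣ using (divides; ∣⇒∣ᵤ) renaming (_∣_ to _∣ℤ_)
import Data.Integer.Properties as ℤₚ
open import Data.Integer.Tactic.RingSolver using (solve-∀)
open import Data.Nat as ℕ using (zero; suc; _<_; z≤n; s≤s; _∸_; _≤?_; _%_; _/_; NonZero; _≤′_; ≤′-refl; ≤′-step)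
  renaming (_+_ to _+ℕ_)
import Data.Nat.DivMod as ℕ
open import Data.Nat.Divisibility using (_∣_; _∣?_; _∣0; ∣m∣n⇒∣m+n; ∣m+n∣m⇒∣n; n∣m*n; m∣m*n; ∣⇒≤)
import Data.Nat.Properties as ℕₚ
import Data.Nat.Tactic.RingSolver as ℕ-Solver
open import Data.Product using (∃-syntax; _,_)
open import Data.Sum using (inj₁; inj₂)
open import Function using (_∘_)
open import Relation.Binary using (Setoid)
import Relation.Binary.Reasoning.Setoid as SetoidReasoning
open import Relation.Binary.PropositionalEquality
open import Relation.Nullary using (¬_; does; Dec; yes; no)
open import Relation.Nullary.Decidable using (dec-true; dec-false)
open import Algebra.Properties.CommutativeSemigroup ℤₚ.+-commutativeSemigroup using (interchange)

if-yes : ∀ {P A : Set} (d : Dec P) {x y : A} → P → (if does d then x else y) ≡ x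
if-yes d p = cong (if_then _ else _) (dec-true d p)

if-no : ∀ {P A : Set} (d : Dec P) {x y : A} → ¬ P → (if does d then x else y) ≡ y
if-no d ¬p = cong (if_then _ else _) (dec-false d ¬p)

sumTo-cong : ∀ n {f g : ℕ → ℤ} → (∀ i → i ≤ n → f i ≡ g i) → sumTo n f ≡ sumTo n g
sumTo-cong zero    f≡g = f≡g 0 z≤n
sumTo-cong (suc n) f≡g = cong₂ _+_ (sumTo-cong n (λ i i≤n → f≡g i (ℕₚ.m≤n⇒m≤1+n i≤n))) (f≡g (suc n) ℕₚ.≤-refl)

sumTo-zeros : ∀ n {f : ℕ → ℤ} → (∀ i → i ≤ n → f i ≡ 0ℤ) → sumTo n f ≡ 0ℤ
sumTo-zeros zero    f≡0 = f≡0 0 z≤n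
sumTo-zeros (suc n) f≡0 = cong₂ _+_ (sumTo-zeros n (λ i i≤n → f≡0 i (ℕₚ.m≤n⇒m≤1+n i≤n))) (f≡0 (suc n) ℕₚ.≤-refl)

sumTo-distrib-+ : ∀ n (f g : ℕ → ℤ) → sumTo n (λ i → f i + g i) ≡ sumTo n f + sumTo n g
sumTo-distrib-+ zero    f g = refl
sumTo-distrib-+ (suc n) f g =
  trans (cong (_+ (f (suc n) + g (suc n))) (sumTo-distrib-+ n f g)) (interchange (sumTo n f) (sumTo n g) (f (suc n)) (g (suc n)))

*-distribˡ-sumTo : ∀ n c (f : ℕ → ℤ) → c * sumTo n f ≡ sumTo n (λ i → c * f i)
*-distribˡ-sumTo zero    c f = refl
*-distribˡ-sumTo (suc n) c f = trans (ℤₚ.*-distribˡ-+ c (sumTo n f) _) (cong (_+ c * f (suc n)) (*-distribˡ-sumTo n c f))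

*-distribʳ-sumTo : ∀ n c (f : ℕ → ℤ) → sumTo n f * c ≡ sumTo n (λ i → f i * c)
*-distribʳ-sumTo zero    c f = refl
*-distribʳ-sumTo (suc n) c f = trans (ℤₚ.*-distribʳ-+ c (sumTo n f) _) (cong (_+ f (suc n) * c) (*-distribʳ-sumTo n c f))

neg-distrib-sumTo : ∀ n (f : ℕ → ℤ) → - sumTo n f ≡ sumTo n (λ i → - f i)
neg-distrib-sumTo zero    f = refl
neg-distrib-sumTo (suc n) f = trans (ℤₚ.neg-distrib-+ (sumTo n f) _) (cong (_+ - f (suc n)) (neg-distrib-sumTo n f))

sumTo-suc : ∀ n (f : ℕ → ℤ) → sumTo (suc n) f ≡ f 0 + sumTo n (f ∘ suc)
sumTo-suc zero    f = refl
sumTo-suc (suc n) f = trans (cong (_+ f (suc (suc n))) (sumTo-suc n f)) (ℤₚ.+-assoc (f 0) _ _)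

sumTo-reverse : ∀ n (f : ℕ → ℤ) → sumTo n f ≡ sumTo n (λ i → f (n ∸ i))
sumTo-reverse zero    f = refl
sumTo-reverse (suc n) f = begin
  sumTo (suc n) f                           ≡⟨ sumTo-suc n f ⟩
  f 0 + sumTo n (f ∘ suc)                   ≡⟨ cong (λ z → f 0 + z) (sumTo-reverse n (f ∘ suc)) ⟩
  f 0 + sumTo n (λ i → f (suc (n ∸ i)))     ≡⟨ ℤₚ.+-comm (f 0) _ ⟩
  sumTo n (λ i → f (suc (n ∸ i))) + f 0     ≡⟨ cong₂ _+_ (sumTo-cong n (λ i i≤n → cong f (sym (ℕₚ.+-∸-assoc 1 i≤n))))
                                                         (cong f (sym (ℕₚ.n∸n≡0 n))) ⟩
  sumTo (suc n) (λ i → f (suc n ∸ i))       ∎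
  where open ≡-Reasoning

sumTo-triangle : ∀ n (F : ℕ → ℕ → ℤ) →
  sumTo n (λ i → sumTo i (λ j → F j i)) ≡ sumTo n (λ j → sumTo (n ∸ j) (λ t → F j (j +ℕ t)))
sumTo-triangle zero    F = refl
sumTo-triangle (suc n) F = begin
  sumTo n (λ i → sumTo i (λ j → F j i)) + (sumTo n (λ j → F j (suc n)) + F (suc n) (suc n))
    ≡⟨ cong (_+ (sumTo n (λ j → F j (suc n)) + F (suc n) (suc n))) (sumTo-triangle n F) ⟩
  R + (sumTo n (λ j → F j (suc n)) + F (suc n) (suc n))
    ≡⟨ sym (ℤₚ.+-assoc R _ _) ⟩
  (R + sumTo n (λ j → F j (suc n))) + F (suc n) (suc n)
    ≡⟨ cong₂ _+_ (sym (sumTo-distrib-+ n _ _)) (cong (F (suc n)) (sym (ℕₚ.+-identityʳ (suc n)))) ⟩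
  sumTo n (λ j → sumTo (n ∸ j) (λ t → F j (j +ℕ t)) + F j (suc n)) + F (suc n) (suc n +ℕ 0)
    ≡⟨ cong₂ _+_ (sumTo-cong n extend-row) (cong (λ z → sumTo z (λ t → F (suc n) (suc n +ℕ t))) (sym (ℕₚ.n∸n≡0 n))) ⟩
  sumTo (suc n) (λ j → sumTo (suc n ∸ j) (λ t → F j (j +ℕ t))) ∎
  where
  open ≡-Reasoning
  R = sumTo n (λ j → sumTo (n ∸ j) (λ t → F j (j +ℕ t)))
  extend-row : ∀ j → j ≤ n →
    sumTo (n ∸ j) (λ t → F j (j +ℕ t)) + F j (suc n) ≡ sumTo (suc n ∸ j) (λ t → F j (j +ℕ t))
  extend-row j j≤n rewrite ℕₚ.+-∸-assoc 1 j≤n =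
    cong (λ z → sumTo (n ∸ j) (λ t → F j (j +ℕ t)) + F j z)
         (sym (trans (ℕₚ.+-suc j (n ∸ j)) (cong suc (ℕₚ.m+[n∸m]≡n j≤n))))

sumTo-single : ∀ n a (f : ℕ → ℤ) → a ≤ n → (∀ i → i ≤ n → i ≢ a → f i ≡ 0ℤ) → sumTo n f ≡ f a
sumTo-single zero    .zero f z≤n _ = refl
sumTo-single (suc n) a f a≤1+n others with ℕₚ.m≤n⇒m<n∨m≡n a≤1+n
... | inj₁ (s≤s a≤n) = trans (cong₂ _+_ (sumTo-single n a f a≤n (λ i i≤n → others i (ℕₚ.m≤n⇒m≤1+n i≤n)))
                                                 (others (suc n) ℕₚ.≤-refl (ℕₚ.<⇒≢ (s≤s a≤n) ∘ sym)))
                                      (ℤₚ.+-identityʳ (f a))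
... | inj₂ refl = trans (cong (_+ f a) (sumTo-zeros n (λ i i≤n → others i (ℕₚ.m≤n⇒m≤1+n i≤n) (ℕₚ.<⇒≢ (s≤s i≤n)))))
                                 (ℤₚ.+-identityˡ (f a))

sumTo-extend : ∀ N t (f : ℕ → ℤ) → (∀ i → N < i → f i ≡ 0ℤ) → sumTo (N +ℕ t) f ≡ sumTo N f
sumTo-extend N zero    f f≡0 = cong (λ z → sumTo z f) (ℕₚ.+-identityʳ N)
sumTo-extend N (suc t) f f≡0 = begin
  sumTo (N +ℕ suc t) f                 ≡⟨ cong (λ z → sumTo z f) (ℕₚ.+-suc N t) ⟩
  sumTo (N +ℕ t) f + f (suc (N +ℕ t))  ≡⟨ cong₂ _+_ (sumTo-extend N t f f≡0) (f≡0 _ (s≤s (ℕₚ.m≤m+n N t))) ⟩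
  sumTo N f + 0ℤ                       ≡⟨ ℤₚ.+-identityʳ _ ⟩
  sumTo N f                            ∎
  where open ≡-Reasoning

sumFrom1-cong : ∀ n {f g : ℕ → ℤ} → (∀ t → f t ≡ g t) → sumFrom1 n f ≡ sumFrom1 n g
sumFrom1-cong zero    f≡g = refl
sumFrom1-cong (suc n) f≡g = cong₂ _+_ (sumFrom1-cong n f≡g) (f≡g (suc n))

sumFrom1-zeros : ∀ n {f : ℕ → ℤ} → (∀ t → 1 ≤ t → t ≤ n → f t ≡ 0ℤ) → sumFrom1 n f ≡ 0ℤ
sumFrom1-zeros zero    f≡0 = refl
sumFrom1-zeros (suc n) f≡0 =
  cong₂ _+_ (sumFrom1-zeros n (λ t 1≤t t≤n → f≡0 t 1≤t (ℕₚ.m≤n⇒m≤1+n t≤n))) (f≡0 (suc n) (s≤s z≤n) ℕₚ.≤-refl)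

sumTo-+ : ∀ a c (f : ℕ → ℤ) → sumTo (a +ℕ c) f ≡ sumTo a f + sumFrom1 c (λ t → f (a +ℕ t))
sumTo-+ a zero    f = trans (cong (λ z → sumTo z f) (ℕₚ.+-identityʳ a)) (sym (ℤₚ.+-identityʳ _))
sumTo-+ a (suc c) f = begin
  sumTo (a +ℕ suc c) f                                        ≡⟨ cong (λ z → sumTo z f) (ℕₚ.+-suc a c) ⟩
  sumTo (a +ℕ c) f + f (suc (a +ℕ c))                         ≡⟨ cong₂ _+_ (sumTo-+ a c f) (cong f (sym (ℕₚ.+-suc a c))) ⟩
  (sumTo a f + sumFrom1 c (λ t → f (a +ℕ t))) + f (a +ℕ suc c) ≡⟨ ℤₚ.+-assoc (sumTo a f) _ _ ⟩
  sumTo a f + sumFrom1 (suc c) (λ t → f (a +ℕ t))             ∎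
  where open ≡-Reasoning

module Congruence (m : ℤ) where

  infix 4 _≋_ _≋ₛ_

  record _≋_ (x y : ℤ) : Set where
    constructor mk≋
    field
      m∣x-y : m ∣ℤ (x - y)

  open _≋_ public

  ≋-reflexive : ∀ {x y} → x ≡ y → x ≋ y
  ≋-reflexive {x} refl = mk≋ (divides 0ℤ (trans (ℤₚ.+-inverseʳ x) (sym (ℤₚ.*-zeroˡ m))))

  ≋-sym : ∀ {x y} → x ≋ y → y ≋ x
  ≋-sym {x} {y} (mk≋ m∣x-y) = mk≋ (subst (m ∣ℤ_) (negate x y) (ℤ∣.∣m⇒∣-m m∣x-y))
    where
    negate : ∀ x y → - (x - y) ≡ y - x
    negate = solve-∀

  ≋-trans : ∀ {x y z} → x ≋ y → y ≋ z → x ≋ z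
  ≋-trans {x} {y} {z} (mk≋ m∣x-y) (mk≋ m∣y-z) = mk≋ (subst (m ∣ℤ_) (telescope x y z) (ℤ∣.∣m∣n⇒∣m+n m∣x-y m∣y-z))
    where
    telescope : ∀ x y z → (x - y) + (y - z) ≡ x - z
    telescope = solve-∀

  ≋-+ : ∀ {a b c d} → a ≋ c → b ≋ d → a + b ≋ c + d
  ≋-+ {a} {b} {c} {d} (mk≋ m∣a-c) (mk≋ m∣b-d) = mk≋ (subst (m ∣ℤ_) (regroup a b c d) (ℤ∣.∣m∣n⇒∣m+n m∣a-c m∣b-d))
    where
    regroup : ∀ a b c d → (a - c) + (b - d) ≡ (a + b) - (c + d)
    regroup = solve-∀

  ≋-* : ∀ {a b c d} → a ≋ c → b ≋ d → a * b ≋ c * d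
  ≋-* {a} {b} {c} {d} (mk≋ m∣a-c) (mk≋ m∣b-d) =
    mk≋ (subst (m ∣ℤ_) (regroup a b c d) (ℤ∣.∣m∣n⇒∣m+n (ℤ∣.∣n⇒∣m*n a m∣b-d) (ℤ∣.∣m⇒∣m*n d m∣a-c)))
    where
    regroup : ∀ a b c d → a * (b - d) + (a - c) * d ≡ a * b - c * d
    regroup = solve-∀

  ≋-setoid : Setoid _ _
  ≋-setoid = record
    { Carrier = ℤ ; _≈_ = _≋_
    ; isEquivalence = record { refl = ≋-reflexive refl ; sym = ≋-sym ; trans = ≋-trans } }

  sumTo-cong-≋ : ∀ n {f g : ℕ → ℤ} → (∀ i → i ≤ n → f i ≋ g i) → sumTo n f ≋ sumTo n g
  sumTo-cong-≋ zero    f≋g = f≋g 0 z≤n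
  sumTo-cong-≋ (suc n) f≋g = ≋-+ (sumTo-cong-≋ n (λ i i≤n → f≋g i (ℕₚ.m≤n⇒m≤1+n i≤n))) (f≋g (suc n) ℕₚ.≤-refl)

  _≋ₛ_ : Series → Series → Set
  f ≋ₛ g = ∀ i → f i ≋ g i

  ≗⇒≋ₛ : ∀ {f g} → f ≗ g → f ≋ₛ g
  ≗⇒≋ₛ f≗g i = ≋-reflexive (f≗g i)

  ≋ₛ-setoid : Setoid _ _
  ≋ₛ-setoid = record
    { Carrier = Series ; _≈_ = _≋ₛ_
    ; isEquivalence = record
      { refl = λ i → ≋-reflexive refl
      ; sym = λ f≋g i → ≋-sym (f≋g i)
      ; trans = λ f≋g g≋h i → ≋-trans (f≋g i) (g≋h i) } }

  ⊛-cong-≋ₛ : ∀ {f f′ g g′} → f ≋ₛ f′ → g ≋ₛ g′ → f ⊛ g ≋ₛ f′ ⊛ g′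
  ⊛-cong-≋ₛ f≋f′ g≋g′ n = sumTo-cong-≋ n (λ i _ → ≋-* (f≋f′ i) (g≋g′ (n ∸ i)))

  powS-cong-≋ₛ : ∀ {f g} e → f ≋ₛ g → powS f e ≋ₛ powS g e
  powS-cong-≋ₛ zero    f≋g i = ≋-reflexive refl
  powS-cong-≋ₛ (suc e) f≋g   = ⊛-cong-≋ₛ f≋g (powS-cong-≋ₛ e f≋g)

module ≗ = Setoid (ℕ →-setoid ℤ)

infixl 6 _-ₛ_

_-ₛ_ : Series → Series → Series
(f -ₛ g) i = f i - g i

shift : ℕ → Series → Series
shift a f i = if does (a ≤? i) then f (i ∸ a) else 0ℤ

⊛-cong : ∀ {f f′ g g′} → f ≗ f′ → g ≗ g′ → f ⊛ g ≗ f′ ⊛ g′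
⊛-cong f≗f′ g≗g′ n = sumTo-cong n (λ i _ → cong₂ _*_ (f≗f′ i) (g≗g′ (n ∸ i)))

⊛-comm : ∀ f g → f ⊛ g ≗ g ⊛ f
⊛-comm f g n = trans (sumTo-reverse n _) (sumTo-cong n (λ i i≤n →
  trans (ℤₚ.*-comm (f (n ∸ i)) _) (cong (λ z → g z * f (n ∸ i)) (ℕₚ.m∸[m∸n]≡n i≤n))))

⊛-assoc : ∀ f g h → (f ⊛ g) ⊛ h ≗ f ⊛ (g ⊛ h)
⊛-assoc f g h n = begin
  sumTo n (λ i → sumTo i (λ j → f j * g (i ∸ j)) * h (n ∸ i))
    ≡⟨ sumTo-cong n (λ i _ → *-distribʳ-sumTo i (h (n ∸ i)) _) ⟩
  sumTo n (λ i → sumTo i (λ j → f j * g (i ∸ j) * h (n ∸ i)))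
    ≡⟨ sumTo-triangle n (λ j i → f j * g (i ∸ j) * h (n ∸ i)) ⟩
  sumTo n (λ j → sumTo (n ∸ j) (λ t → f j * g ((j +ℕ t) ∸ j) * h (n ∸ (j +ℕ t))))
    ≡⟨ sumTo-cong n (λ j _ → sumTo-cong (n ∸ j) (λ t _ → trans (ℤₚ.*-assoc (f j) _ _)
         (cong₂ (λ u v → f j * (g u * h v)) (ℕₚ.m+n∸m≡n j t) (sym (ℕₚ.∸-+-assoc n j t))))) ⟩
  sumTo n (λ j → sumTo (n ∸ j) (λ t → f j * (g t * h (n ∸ j ∸ t))))
    ≡⟨ sumTo-cong n (λ j _ → sym (*-distribˡ-sumTo (n ∸ j) (f j) _)) ⟩
  sumTo n (λ j → f j * sumTo (n ∸ j) (λ t → g t * h (n ∸ j ∸ t))) ∎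
  where open ≡-Reasoning

⊛-interchange : ∀ f g h k → (f ⊛ g) ⊛ (h ⊛ k) ≗ (f ⊛ h) ⊛ (g ⊛ k)
⊛-interchange f g h k = ≗.trans (⊛-assoc f g (h ⊛ k)) (≗.trans (⊛-cong {f} ≗.refl inner) (≗.sym (⊛-assoc f h (g ⊛ k))))
  where
  inner : g ⊛ (h ⊛ k) ≗ h ⊛ (g ⊛ k)
  inner = ≗.trans (≗.sym (⊛-assoc g h k)) (≗.trans (⊛-cong {g′ = k} (⊛-comm g h) ≗.refl) (⊛-assoc h g k))

qPow-⊛ : ∀ a f → qPow a ⊛ f ≗ shift a f
qPow-⊛ a f n with a ≤? n
... | yes a≤n = trans (sumTo-single n a _ a≤n (λ i _ i≢a → cong (_* f (n ∸ i)) (if-no (i ℕ.≟ a) i≢a)))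
                      (trans (cong (_* f (n ∸ a)) (if-yes (a ℕ.≟ a) refl))
                             (trans (ℤₚ.*-identityˡ _) (sym (if-yes (a ≤? n) a≤n))))
... | no  a≰n = trans (sumTo-zeros n (λ i i≤n → cong (_* f (n ∸ i)) (if-no (i ℕ.≟ a) (λ i≡a → a≰n (subst (_≤ n) i≡a i≤n)))))
                      (sym (if-no (a ≤? n) a≰n))

⊛-identityˡ : ∀ f → oneS ⊛ f ≗ f
⊛-identityˡ = qPow-⊛ 0

⊛-identityʳ : ∀ f → f ⊛ oneS ≗ f
⊛-identityʳ f = ≗.trans (⊛-comm f oneS) (⊛-identityˡ f)

⊛-distribʳ--ₛ : ∀ f g h → (f -ₛ g) ⊛ h ≗ (f ⊛ h) -ₛ (g ⊛ h)
⊛-distribʳ--ₛ f g h n = begin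
  sumTo n (λ i → (f i - g i) * h (n ∸ i))
    ≡⟨ sumTo-cong n (λ i _ → trans (ℤₚ.*-distribʳ-+ (h (n ∸ i)) (f i) (- g i))
                                   (cong (λ z → f i * h (n ∸ i) + z) (sym (ℤₚ.neg-distribˡ-* (g i) (h (n ∸ i)))))) ⟩
  sumTo n (λ i → f i * h (n ∸ i) + - (g i * h (n ∸ i)))
    ≡⟨ sumTo-distrib-+ n _ _ ⟩
  sumTo n (λ i → f i * h (n ∸ i)) + sumTo n (λ i → - (g i * h (n ∸ i)))
    ≡⟨ cong (λ z → sumTo n (λ i → f i * h (n ∸ i)) + z) (sym (neg-distrib-sumTo n _)) ⟩
  (f ⊛ h) n - (g ⊛ h) n ∎
  where open ≡-Reasoning

oneMinusQ-⊛ : ∀ a f → oneMinusQ a ⊛ f ≗ f -ₛ shift a f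
oneMinusQ-⊛ a f n = trans (⊛-distribʳ--ₛ oneS (qPow a) f n) (cong₂ _-_ (⊛-identityˡ f n) (qPow-⊛ a f n))

powS-+ : ∀ f m n → powS f (m +ℕ n) ≗ powS f m ⊛ powS f n
powS-+ f zero    n = ≗.sym (⊛-identityˡ (powS f n))
powS-+ f (suc m) n = ≗.trans (⊛-cong {f} ≗.refl (powS-+ f m n)) (≗.sym (⊛-assoc f (powS f m) (powS f n)))

powS-* : ∀ f m n → powS f (m *ℕ n) ≗ powS (powS f n) m
powS-* f zero    n = ≗.refl
powS-* f (suc m) n = ≗.trans (powS-+ f n (m *ℕ n)) (⊛-cong {powS f n} ≗.refl (powS-* f m n))

shift-cong : ∀ a {f g} → f ≗ g → shift a f ≗ shift a g
shift-cong a f≗g i with does (a ≤? i)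
... | true  = f≗g (i ∸ a)
... | false = refl

shift-distrib--ₛ : ∀ a f g → shift a (f -ₛ g) ≗ shift a f -ₛ shift a g
shift-distrib--ₛ a f g i with does (a ≤? i)
... | true  = refl
... | false = refl

shift-shift : ∀ a b f → shift a (shift b f) ≗ shift (b +ℕ a) f
shift-shift a b f i with a ≤? i
... | no a≰i = trans (if-no (a ≤? i) a≰i) (sym (if-no (b +ℕ a ≤? i) (a≰i ∘ ℕₚ.≤-trans (ℕₚ.m≤n+m a b))))
... | yes a≤i with b ≤? i ∸ a
...   | yes b≤i-a = begin
  shift a (shift b f) i ≡⟨ if-yes (a ≤? i) a≤i ⟩
  shift b f (i ∸ a)     ≡⟨ if-yes (b ≤? i ∸ a) b≤i-a ⟩
  f (i ∸ a ∸ b)         ≡⟨ cong f (trans (ℕₚ.∸-+-assoc i a b) (cong (i ∸_) (ℕₚ.+-comm a b))) ⟩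
  f (i ∸ (b +ℕ a))      ≡⟨ sym (if-yes (b +ℕ a ≤? i) (subst (b +ℕ a ≤_) (ℕₚ.m∸n+n≡m a≤i) (ℕₚ.+-monoˡ-≤ a b≤i-a))) ⟩
  shift (b +ℕ a) f i    ∎
    where open ≡-Reasoning
...   | no b≰i-a = trans (if-yes (a ≤? i) a≤i) (trans (if-no (b ≤? i ∸ a) b≰i-a)
  (sym (if-no (b +ℕ a ≤? i) (λ b+a≤i → b≰i-a (subst (_≤ i ∸ a) (ℕₚ.m+n∸n≡m b a) (ℕₚ.∸-monoˡ-≤ a b+a≤i))))))

shift-oneS : ∀ a → shift a oneS ≗ qPow a
shift-oneS a = ≗.trans (≗.sym (qPow-⊛ a oneS)) (⊛-identityʳ (qPow a))

AgreeUpTo : ℕ → Series → Series → Set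
AgreeUpTo N f g = ∀ i → i ≤ N → f i ≡ g i

⊛-agree : ∀ N {f f′ g g′} → AgreeUpTo N f f′ → AgreeUpTo N g g′ → AgreeUpTo N (f ⊛ g) (f′ ⊛ g′)
⊛-agree N f≡f′ g≡g′ i i≤N = sumTo-cong i (λ j j≤i →
  cong₂ _*_ (f≡f′ j (ℕₚ.≤-trans j≤i i≤N)) (g≡g′ (i ∸ j) (ℕₚ.≤-trans (ℕₚ.m∸n≤m i j) i≤N)))

-- Frobenius modulo 3

open Congruence (+ 3)

oneMinusQ-cube : ∀ a → powS (oneMinusQ a) 3 ≋ₛ oneMinusQ (3 *ℕ a)
oneMinusQ-cube a i =
  ≋-trans (≋-reflexive expand) (≋-trans (mk≋ (divides (x₂ - x₁) (mod3 x₀ x₁ x₂ x₃))) (≋-reflexive (cong (λ z → x₀ - z) x₃≡qPow)))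
  where
  open ≡-Reasoning
  S : Series → Series
  S = shift a
  D : Series → Series
  D g = g -ₛ S g
  D-cong : ∀ {g h} → g ≗ h → D g ≗ D h
  D-cong g≗h j = cong₂ _-_ (g≗h j) (shift-cong a g≗h j)
  D²-at : ∀ g j → D (D g) j ≡ (g j - S g j) - (S g j - S (S g) j)
  D²-at g j = cong (λ z → (g j - S g j) - z) (shift-distrib--ₛ a g (S g) j)
  x₀ = oneS i
  x₁ = S oneS i
  x₂ = S (S oneS) i
  x₃ = S (S (S oneS)) i
  f = oneMinusQ a
  expand : powS f 3 i ≡ ((x₀ - x₁) - (x₁ - x₂)) - ((x₁ - x₂) - (x₂ - x₃))
  expand = begin
    powS f 3 i             ≡⟨ ⊛-cong {f} ≗.refl (⊛-cong {f} ≗.refl (oneMinusQ-⊛ a oneS)) i ⟩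
    (f ⊛ (f ⊛ D oneS)) i   ≡⟨ ⊛-cong {f} ≗.refl (oneMinusQ-⊛ a (D oneS)) i ⟩
    (f ⊛ D (D oneS)) i     ≡⟨ oneMinusQ-⊛ a (D (D oneS)) i ⟩
    D (D oneS) i - S (D (D oneS)) i
      ≡⟨ cong₂ _-_ (D²-at oneS i) (trans (shift-distrib--ₛ a (D oneS) (S (D oneS)) i) (D-cong (shift-distrib--ₛ a oneS (S oneS)) i)) ⟩
    ((x₀ - x₁) - (x₁ - x₂)) - D (D (S oneS)) i
      ≡⟨ cong (λ z → ((x₀ - x₁) - (x₁ - x₂)) - z) (D²-at (S oneS) i) ⟩
    ((x₀ - x₁) - (x₁ - x₂)) - ((x₁ - x₂) - (x₂ - x₃)) ∎
  mod3 : ∀ x₀ x₁ x₂ x₃ → (((x₀ - x₁) - (x₁ - x₂)) - ((x₁ - x₂) - (x₂ - x₃))) - (x₀ - x₃) ≡ (x₂ - x₁) * + 3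
  mod3 = solve-∀
  3a≡a+[a+a] : 3 *ℕ a ≡ a +ℕ (a +ℕ a)
  3a≡a+[a+a] = cong (λ b → a +ℕ (a +ℕ b)) (ℕₚ.+-identityʳ a)
  x₃≡qPow : x₃ ≡ qPow (3 *ℕ a) i
  x₃≡qPow = begin
    x₃                       ≡⟨ shift-shift a a (S oneS) i ⟩
    shift (a +ℕ a) (S oneS) i ≡⟨ shift-shift (a +ℕ a) a oneS i ⟩
    shift (a +ℕ (a +ℕ a)) oneS i ≡⟨ shift-oneS _ i ⟩
    qPow (a +ℕ (a +ℕ a)) i   ≡⟨ cong (λ b → qPow b i) (sym 3a≡a+[a+a]) ⟩
    qPow (3 *ℕ a) i          ∎

oneMinusQ-pow-3^ : ∀ t a → powS (oneMinusQ a) (3 ^ t) ≋ₛ oneMinusQ (3 ^ t *ℕ a)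
oneMinusQ-pow-3^ zero    a = ≗⇒≋ₛ (≗.trans (⊛-identityʳ (oneMinusQ a)) (λ i → cong (λ b → oneMinusQ b i) (sym (ℕₚ.+-identityʳ a))))
oneMinusQ-pow-3^ (suc t) a = begin
  powS (oneMinusQ a) (3 *ℕ 3 ^ t)        ≈⟨ ≗⇒≋ₛ (powS-* (oneMinusQ a) 3 (3 ^ t)) ⟩
  powS (powS (oneMinusQ a) (3 ^ t)) 3    ≈⟨ powS-cong-≋ₛ 3 (oneMinusQ-pow-3^ t a) ⟩
  powS (oneMinusQ (3 ^ t *ℕ a)) 3        ≈⟨ oneMinusQ-cube (3 ^ t *ℕ a) ⟩
  oneMinusQ (3 *ℕ (3 ^ t *ℕ a))          ≡⟨ cong oneMinusQ (sym (ℕₚ.*-assoc 3 (3 ^ t) a)) ⟩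
  oneMinusQ (3 ^ suc t *ℕ a)             ∎
  where open SetoidReasoning ≋ₛ-setoid

powS-oneMinusQ-⊛-oneMinusQ : ∀ {e t} → e +ℕ 3 ≡ 3 ^ t → ∀ c →
  powS (oneMinusQ c) e ⊛ oneMinusQ (3 *ℕ c) ≋ₛ oneMinusQ (3 ^ t *ℕ c)
powS-oneMinusQ-⊛-oneMinusQ {e} {t} e+3≡3^t c = begin
  powS f e ⊛ oneMinusQ (3 *ℕ c)  ≈⟨ ⊛-cong-≋ₛ {powS f e} (≗⇒≋ₛ ≗.refl) (oneMinusQ-cube c) ⟨
  powS f e ⊛ powS f 3            ≈⟨ ≗⇒≋ₛ (powS-+ f e 3) ⟨
  powS f (e +ℕ 3)                ≡⟨ cong (powS f) e+3≡3^t ⟩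
  powS f (3 ^ t)                 ≈⟨ oneMinusQ-pow-3^ t c ⟩
  oneMinusQ (3 ^ t *ℕ c)         ∎
  where
  f = oneMinusQ c
  open SetoidReasoning ≋ₛ-setoid

prodTrunc-⊛-prodTrunc : ∀ {e t} → e +ℕ 3 ≡ 3 ^ t → ∀ c M →
  prodTrunc c e M ⊛ prodTrunc (3 *ℕ c) 1 M ≋ₛ prodTrunc (3 ^ t *ℕ c) 1 M
prodTrunc-⊛-prodTrunc e+3≡3^t c zero = ≗⇒≋ₛ (⊛-identityˡ oneS)
prodTrunc-⊛-prodTrunc {e} {t} e+3≡3^t c (suc M) = begin
  (prodTrunc c e M ⊛ powS f e) ⊛ (prodTrunc (3 *ℕ c) 1 M ⊛ powS (oneMinusQ (3 *ℕ c *ℕ suc M)) 1)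
    ≈⟨ ≗⇒≋ₛ (⊛-interchange (prodTrunc c e M) (powS f e) (prodTrunc (3 *ℕ c) 1 M) (powS (oneMinusQ (3 *ℕ c *ℕ suc M)) 1)) ⟩
  (prodTrunc c e M ⊛ prodTrunc (3 *ℕ c) 1 M) ⊛ (powS f e ⊛ powS (oneMinusQ (3 *ℕ c *ℕ suc M)) 1)
    ≈⟨ ⊛-cong-≋ₛ {prodTrunc c e M ⊛ prodTrunc (3 *ℕ c) 1 M} (prodTrunc-⊛-prodTrunc {e} {t} e+3≡3^t c M) new-factors ⟩
  prodTrunc (3 ^ t *ℕ c) 1 M ⊛ powS (oneMinusQ (3 ^ t *ℕ c *ℕ suc M)) 1 ∎
  where
  open SetoidReasoning ≋ₛ-setoid
  f = oneMinusQ (c *ℕ suc M)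
  new-factors : powS f e ⊛ powS (oneMinusQ (3 *ℕ c *ℕ suc M)) 1 ≋ₛ powS (oneMinusQ (3 ^ t *ℕ c *ℕ suc M)) 1
  new-factors = begin
    powS f e ⊛ powS (oneMinusQ (3 *ℕ c *ℕ suc M)) 1 ≈⟨ ≗⇒≋ₛ (⊛-cong {powS f e} ≗.refl (⊛-identityʳ (oneMinusQ (3 *ℕ c *ℕ suc M)))) ⟩
    powS f e ⊛ oneMinusQ (3 *ℕ c *ℕ suc M)          ≡⟨ cong (λ b → powS f e ⊛ oneMinusQ b) (ℕₚ.*-assoc 3 c (suc M)) ⟩
    powS f e ⊛ oneMinusQ (3 *ℕ (c *ℕ suc M))        ≈⟨ powS-oneMinusQ-⊛-oneMinusQ {e} {t} e+3≡3^t (c *ℕ suc M) ⟩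
    oneMinusQ (3 ^ t *ℕ (c *ℕ suc M))                ≡⟨ cong oneMinusQ (ℕₚ.*-assoc (3 ^ t) c (suc M)) ⟨
    oneMinusQ (3 ^ t *ℕ c *ℕ suc M)                  ≈⟨ ≗⇒≋ₛ (⊛-identityʳ (oneMinusQ (3 ^ t *ℕ c *ℕ suc M))) ⟨
    powS (oneMinusQ (3 ^ t *ℕ c *ℕ suc M)) 1        ∎

powS-oneMinusQ-below : ∀ a e i → i < a → powS (oneMinusQ a) e i ≡ oneS i
powS-oneMinusQ-below a zero    i i<a = refl
powS-oneMinusQ-below a (suc e) i i<a = begin
  (oneMinusQ a ⊛ powS (oneMinusQ a) e) i             ≡⟨ oneMinusQ-⊛ a (powS (oneMinusQ a) e) i ⟩
  powS (oneMinusQ a) e i - shift a (powS (oneMinusQ a) e) i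
    ≡⟨ cong₂ _-_ (powS-oneMinusQ-below a e i i<a) (if-no (a ≤? i) (ℕₚ.<⇒≱ i<a)) ⟩
  oneS i - 0ℤ                                        ≡⟨ ℤₚ.+-identityʳ _ ⟩
  oneS i                                             ∎
  where open ≡-Reasoning

prodTrunc-suc-agree : ∀ {c} e M → 1 ≤ c → AgreeUpTo M (prodTrunc c e (suc M)) (prodTrunc c e M)
prodTrunc-suc-agree {c} e M 1≤c i i≤M =
  trans (⊛-agree i {prodTrunc c e M} (λ _ _ → refl) last-factor≡1 i ℕₚ.≤-refl) (⊛-identityʳ (prodTrunc c e M) i)
  where
  M<c[1+M] : M < c *ℕ suc M
  M<c[1+M] = subst (_≤ c *ℕ suc M) (ℕₚ.*-identityˡ (suc M)) (ℕₚ.*-monoˡ-≤ (suc M) 1≤c)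
  last-factor≡1 : AgreeUpTo i (powS (oneMinusQ (c *ℕ suc M)) e) oneS
  last-factor≡1 j j≤i = powS-oneMinusQ-below _ e j (ℕₚ.≤-trans (s≤s (ℕₚ.≤-trans j≤i i≤M)) M<c[1+M])

prodTrunc-agree : ∀ {c} e {i M} → 1 ≤ c → i ≤′ M → prodTrunc c e M i ≡ prodCoeff c e i
prodTrunc-agree e 1≤c ≤′-refl               = refl
prodTrunc-agree e 1≤c (≤′-step {M} i≤′M) =
  trans (prodTrunc-suc-agree e M 1≤c _ (ℕₚ.≤′⇒≤ i≤′M)) (prodTrunc-agree e 1≤c i≤′M)

prodTrunc-agreeUpTo : ∀ {c} e M → 1 ≤ c → AgreeUpTo M (prodTrunc c e M) (prodCoeff c e)
prodTrunc-agreeUpTo e M 1≤c i i≤M = prodTrunc-agree e 1≤c (ℕₚ.≤⇒≤′ i≤M)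

OnMultiples : ℕ → Series → Set
OnMultiples d f = ∀ i → ¬ d ∣ i → f i ≡ 0ℤ

⊛-onMultiples : ∀ d {f g} → OnMultiples d f → OnMultiples d g → OnMultiples d (f ⊛ g)
⊛-onMultiples d {f} {g} f-on g-on i d∤i = sumTo-zeros i term≡0
  where
  term≡0 : ∀ j → j ≤ i → f j * g (i ∸ j) ≡ 0ℤ
  term≡0 j j≤i with d ∣? j
  ... | yes d∣j = trans (cong (f j *_) (g-on (i ∸ j) (λ d∣i-j → d∤i (subst (d ∣_) (ℕₚ.m+[n∸m]≡n j≤i) (∣m∣n⇒∣m+n d∣j d∣i-j)))))
                        (ℤₚ.*-zeroʳ (f j))
  ... | no  d∤j = cong (_* g (i ∸ j)) (f-on j d∤j)

oneS-onMultiples : ∀ d → OnMultiples d oneS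
oneS-onMultiples d i d∤i = if-no (i ℕ.≟ 0) (λ i≡0 → d∤i (subst (d ∣_) (sym i≡0) (d ∣0)))

oneMinusQ-onMultiples : ∀ d k → OnMultiples d (oneMinusQ (d *ℕ k))
oneMinusQ-onMultiples d k i d∤i =
  cong₂ _-_ (oneS-onMultiples d i d∤i) (if-no (i ℕ.≟ d *ℕ k) (λ i≡dk → d∤i (subst (d ∣_) (sym i≡dk) (m∣m*n k))))

powS-onMultiples : ∀ d {f} e → OnMultiples d f → OnMultiples d (powS f e)
powS-onMultiples d zero    f-on = oneS-onMultiples d
powS-onMultiples d (suc e) f-on = ⊛-onMultiples d f-on (powS-onMultiples d e f-on)

prodTrunc-onMultiples : ∀ d e M → OnMultiples d (prodTrunc d e M)
prodTrunc-onMultiples d e zero    = oneS-onMultiples d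
prodTrunc-onMultiples d e (suc M) =
  ⊛-onMultiples d (prodTrunc-onMultiples d e M) (powS-onMultiples d e (oneMinusQ-onMultiples d (suc M)))

prodCoeff-onMultiples : ∀ d e → OnMultiples d (prodCoeff d e)
prodCoeff-onMultiples d e i = prodTrunc-onMultiples d e i i

sumTo-multiples : ∀ d M (f : ℕ → ℤ) → OnMultiples (suc d) f →
  sumTo (M *ℕ suc d) f ≡ f 0 + sumFrom1 M (λ j → f (j *ℕ suc d))
sumTo-multiples d zero    f f-on = sym (ℤₚ.+-identityʳ (f 0))
sumTo-multiples d (suc M) f f-on = begin
  sumTo (suc M *ℕ suc d) f                                      ≡⟨ cong (λ z → sumTo z f) (ℕₚ.+-comm (suc d) (M *ℕ suc d)) ⟩
  sumTo (M *ℕ suc d +ℕ suc d) f                                 ≡⟨ sumTo-+ (M *ℕ suc d) (suc d) f ⟩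
  sumTo (M *ℕ suc d) f + sumFrom1 (suc d) (λ t → f (M *ℕ suc d +ℕ t))
    ≡⟨ cong₂ _+_ (sumTo-multiples d M f f-on) block ⟩
  (f 0 + sumFrom1 M (λ j → f (j *ℕ suc d))) + f (suc M *ℕ suc d) ≡⟨ ℤₚ.+-assoc (f 0) _ _ ⟩
  f 0 + sumFrom1 (suc M) (λ j → f (j *ℕ suc d))                 ∎
  where
  open ≡-Reasoning
  block : sumFrom1 (suc d) (λ t → f (M *ℕ suc d +ℕ t)) ≡ f (suc M *ℕ suc d)
  block = trans (cong₂ _+_ (sumFrom1-zeros d (λ t 1≤t t≤d → f-on (M *ℕ suc d +ℕ t)
                   (λ 1+d∣ → ℕₚ.<⇒≱ (s≤s t≤d) (∣⇒≤ {{ℕ.>-nonZero 1≤t}} (∣m+n∣m⇒∣n 1+d∣ (n∣m*n M))))))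
                           (cong f (ℕₚ.+-comm (M *ℕ suc d) (suc d))))
                (ℤₚ.+-identityˡ _)

sumTo-onMultiples : ∀ d N M (f : ℕ → ℤ) → N ≤ M → OnMultiples (suc d) f → (∀ i → N < i → f i ≡ 0ℤ) →
  sumTo N f ≡ f 0 + sumFrom1 M (λ j → f (suc d *ℕ j))
sumTo-onMultiples d N M f N≤M f-on f-vanishes = begin
  sumTo N f                                   ≡⟨ sumTo-extend N (M *ℕ suc d ∸ N) f f-vanishes ⟨
  sumTo (N +ℕ (M *ℕ suc d ∸ N)) f             ≡⟨ cong (λ z → sumTo z f) (ℕₚ.m+[n∸m]≡n (ℕₚ.≤-trans N≤M (ℕₚ.m≤m*n M (suc d)))) ⟩
  sumTo (M *ℕ suc d) f                        ≡⟨ sumTo-multiples d M f f-on ⟩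
  f 0 + sumFrom1 M (λ j → f (j *ℕ suc d))     ≡⟨ cong (λ z → f 0 + z) (sumFrom1-cong M (λ j → cong f (ℕₚ.*-comm j (suc d)))) ⟩
  f 0 + sumFrom1 M (λ j → f (suc d *ℕ j))     ∎
  where open ≡-Reasoning

-- Partitions and Euler's identity

removeIfFits : ℕ → ℕ → (ℕ → ℕ) → ℕ
removeIfFits x N g = if does (x ≤? N) then g (N ∸ x) else 0

-- cappedParts n k J counts the partitions of n into parts ≤ k + 1 using the part k + 1 at most
-- J times; cappedParts n k is the local function in the definition of partsLE n (suc k).
cappedParts : ℕ → ℕ → ℕ → ℕ
cappedParts n k zero    = partsLE n k
cappedParts n k (suc J) = cappedParts n k J +ℕ removeIfFits (suc J *ℕ suc k) n (λ m → partsLE m k)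

-- The local function cannot be named, so the left-hand side of go≡cappedParts is left as a
-- metavariable; the use below, at pairwise distinct variables, solves it.
mutual
  go≡cappedParts : ∀ n k J → _ ≡ cappedParts n k J
  go≡cappedParts n k zero    = refl
  go≡cappedParts n k (suc J) = cong₂ _+ℕ_ (go≡cappedParts n k J) refl

  partsLE-suc≡cappedParts : ∀ n k → partsLE n (suc k) ≡ cappedParts n k n
  partsLE-suc≡cappedParts zero    k = refl
  partsLE-suc≡cappedParts (suc m) k with suc m
  ... | n = cong₂ _+ℕ_ (go≡cappedParts n k m) refl

removeIfFits-+ : ∀ a x N g → a ≤ N → removeIfFits (a +ℕ x) N g ≡ removeIfFits x (N ∸ a) g
removeIfFits-+ a x N g a≤N with x ≤? N ∸ a
... | yes x≤N-a = trans (if-yes (a +ℕ x ≤? N) (subst (a +ℕ x ≤_) (ℕₚ.m+[n∸m]≡n a≤N) (ℕₚ.+-monoʳ-≤ a x≤N-a)))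
                        (trans (cong g (sym (ℕₚ.∸-+-assoc N a x))) (sym (if-yes (x ≤? N ∸ a) x≤N-a)))
... | no  x≰N-a = trans (if-no (a +ℕ x ≤? N) (λ a+x≤N → x≰N-a (subst (_≤ N ∸ a) (ℕₚ.m+n∸m≡n a x) (ℕₚ.∸-monoˡ-≤ a a+x≤N))))
                        (sym (if-no (x ≤? N ∸ a) x≰N-a))

removeIfFits-large : ∀ x N g → N < x → removeIfFits x N g ≡ 0
removeIfFits-large x N g N<x = if-no (x ≤? N) (ℕₚ.<⇒≱ N<x)

cappedParts-fits : ∀ N k J → suc k ≤ N → cappedParts N k (suc J) ≡ partsLE N k +ℕ cappedParts (N ∸ suc k) k J
cappedParts-fits N k zero    1+k≤N =
  cong (partsLE N k +ℕ_) (trans (removeIfFits-+ (suc k) 0 N (λ m → partsLE m k) 1+k≤N) (if-yes (0 ≤? N ∸ suc k) {y = 0} z≤n))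
cappedParts-fits N k (suc J) 1+k≤N = begin
  cappedParts N k (suc J) +ℕ removeIfFits (suc k +ℕ suc J *ℕ suc k) N G
    ≡⟨ cong₂ _+ℕ_ (cappedParts-fits N k J 1+k≤N) (removeIfFits-+ (suc k) _ N G 1+k≤N) ⟩
  (partsLE N k +ℕ cappedParts (N ∸ suc k) k J) +ℕ removeIfFits (suc J *ℕ suc k) (N ∸ suc k) G
    ≡⟨ ℕₚ.+-assoc (partsLE N k) _ _ ⟩
  partsLE N k +ℕ cappedParts (N ∸ suc k) k (suc J) ∎
  where
  open ≡-Reasoning
  G = λ m → partsLE m k

cappedParts-too-large : ∀ N k J → N < suc k → cappedParts N k J ≡ partsLE N k
cappedParts-too-large N k zero    N<1+k = refl
cappedParts-too-large N k (suc J) N<1+k =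
  trans (cong₂ _+ℕ_ (cappedParts-too-large N k J N<1+k)
                    (removeIfFits-large (suc J *ℕ suc k) N (λ m → partsLE m k) (ℕₚ.<-≤-trans N<1+k (ℕₚ.m≤m+n (suc k) _))))
        (ℕₚ.+-identityʳ _)

cappedParts-stable : ∀ N k {J} → N ≤′ J → cappedParts N k J ≡ cappedParts N k N
cappedParts-stable N k ≤′-refl               = refl
cappedParts-stable N k (≤′-step {J} N≤′J) =
  trans (cong₂ _+ℕ_ (cappedParts-stable N k N≤′J)
                    (removeIfFits-large (suc J *ℕ suc k) N (λ m → partsLE m k) (ℕₚ.<-≤-trans (s≤s (ℕₚ.≤′⇒≤ N≤′J)) (ℕₚ.m≤m*n (suc J) (suc k)))))
        (ℕₚ.+-identityʳ _)

partsLE-suc : ∀ u k → partsLE u (suc k) ≡ partsLE u k +ℕ removeIfFits (suc k) u (λ m → partsLE m (suc k))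
partsLE-suc zero    k = sym (ℕₚ.+-identityʳ _)
partsLE-suc (suc u) k with suc k ≤? suc u
... | yes 1+k≤1+u = begin
  partsLE (suc u) (suc k)                         ≡⟨ partsLE-suc≡cappedParts (suc u) k ⟩
  cappedParts (suc u) k (suc u)                   ≡⟨ cappedParts-fits (suc u) k u 1+k≤1+u ⟩
  partsLE (suc u) k +ℕ cappedParts (u ∸ k) k u    ≡⟨ cong (partsLE (suc u) k +ℕ_) (cappedParts-stable (u ∸ k) k (ℕₚ.≤⇒≤′ (ℕₚ.m∸n≤m u k))) ⟩
  partsLE (suc u) k +ℕ cappedParts (u ∸ k) k (u ∸ k) ≡⟨ cong (partsLE (suc u) k +ℕ_) (partsLE-suc≡cappedParts (u ∸ k) k) ⟨
  partsLE (suc u) k +ℕ partsLE (u ∸ k) (suc k)    ≡⟨ cong (partsLE (suc u) k +ℕ_) (if-yes (suc k ≤? suc u) 1+k≤1+u) ⟨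
  partsLE (suc u) k +ℕ removeIfFits (suc k) (suc u) (λ m → partsLE m (suc k)) ∎
  where open ≡-Reasoning
... | no 1+k≰1+u = begin
  partsLE (suc u) (suc k)          ≡⟨ partsLE-suc≡cappedParts (suc u) k ⟩
  cappedParts (suc u) k (suc u)    ≡⟨ cappedParts-too-large (suc u) k (suc u) (ℕₚ.≰⇒> 1+k≰1+u) ⟩
  partsLE (suc u) k                ≡⟨ ℕₚ.+-identityʳ _ ⟨
  partsLE (suc u) k +ℕ 0           ≡⟨ cong (partsLE (suc u) k +ℕ_) (if-no (suc k ≤? suc u) 1+k≰1+u) ⟨
  partsLE (suc u) k +ℕ removeIfFits (suc k) (suc u) (λ m → partsLE m (suc k)) ∎
  where open ≡-Reasoning

partsLE-stable : ∀ {u k} → u ≤′ k → partsLE u k ≡ p u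
partsLE-stable ≤′-refl = refl
partsLE-stable {u} (≤′-step {k} u≤′k) =
  trans (partsLE-suc u k)
        (trans (cong₂ _+ℕ_ (partsLE-stable u≤′k) (removeIfFits-large (suc k) u (λ m → partsLE m (suc k)) (s≤s (ℕₚ.≤′⇒≤ u≤′k))))
               (ℕₚ.+-identityʳ _))

partsLESeries : ℕ → Series
partsLESeries k m = + partsLE m k

partsLESeries-zero : partsLESeries 0 ≗ oneS
partsLESeries-zero m = if-float +_ (does (m ℕ.≟ 0))

partsLESeries-suc : ∀ k → partsLESeries (suc k) -ₛ shift (suc k) (partsLESeries (suc k)) ≗ partsLESeries k
partsLESeries-suc k m = begin
  + partsLE m (suc k) - shift (suc k) (partsLESeries (suc k)) m
    ≡⟨ cong₂ _-_ (cong +_ (partsLE-suc m k)) (sym (if-float +_ (does (suc k ≤? m)))) ⟩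
  + (partsLE m k +ℕ R) - + R   ≡⟨ cong (_- + R) (ℤₚ.pos-+ (partsLE m k) R) ⟩
  (+ partsLE m k + + R) - + R  ≡⟨ cancel (+ partsLE m k) (+ R) ⟩
  + partsLE m k                ∎
  where
  open ≡-Reasoning
  R = removeIfFits (suc k) m (λ m′ → partsLE m′ (suc k))
  cancel : ∀ x y → (x + y) - y ≡ x
  cancel = solve-∀

ifZero : ℕ → ℤ → ℤ
ifZero zero    x = x
ifZero (suc _) _ = 0ℤ

ifZero-cong : ∀ r {x y} → (r ≡ 0 → x ≡ y) → ifZero r x ≡ ifZero r y
ifZero-cong zero    x≡y = x≡y refl
ifZero-cong (suc r) _   = refl

ifZero-0ℤ : ∀ r → ifZero r 0ℤ ≡ 0ℤ
ifZero-0ℤ zero    = refl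
ifZero-0ℤ (suc r) = refl

-- dilate c f is f(q^c).
dilate : (c : ℕ) .{{_ : NonZero c}} → Series → Series
dilate c f i = ifZero (i % c) (f (i / c))

module _ (c : ℕ) .{{_ : NonZero c}} where

  dilate-cong : ∀ {f g} → f ≗ g → dilate c f ≗ dilate c g
  dilate-cong f≗g i = cong (ifZero (i % c)) (f≗g (i / c))

  dilate--ₛ : ∀ f g → dilate c (f -ₛ g) ≗ dilate c f -ₛ dilate c g
  dilate--ₛ f g i with i % c
  ... | zero  = refl
  ... | suc _ = refl

  dilate-oneS : dilate c oneS ≗ oneS
  dilate-oneS i with i % c | i / c | ℕ.m≡m%n+[m/n]*n i c
  ... | zero  | zero  | i≡0  = cong oneS (sym i≡0)
  ... | zero  | suc q | i≡c+ = sym (if-no (i ℕ.≟ 0) (λ i≡0 → ℕ.≢-nonZero⁻¹ c (ℕₚ.m+n≡0⇒m≡0 c (trans (sym i≡c+) i≡0))))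
  ... | suc r | _     | i≡1+ = sym (if-no (i ℕ.≟ 0) (λ i≡0 → ℕₚ.0≢1+n (trans (sym i≡0) i≡1+)))

  dilate-shift : ∀ a f → shift (a *ℕ c) (dilate c f) ≗ dilate c (shift a f)
  dilate-shift a f i with a *ℕ c ≤? i
  ... | yes ac≤i = begin
    shift (a *ℕ c) (dilate c f) i           ≡⟨ if-yes (a *ℕ c ≤? i) ac≤i ⟩
    dilate c f (i ∸ a *ℕ c)                 ≡⟨ cong₂ (λ r q → ifZero r (f q)) (ℕ.m*n≤o⇒[o∸m*n]%n≡o%n a ac≤i) (ℕ.[m∸n*o]/o≡m/o∸n i a c) ⟩
    ifZero (i % c) (f (i / c ∸ a))          ≡⟨ ifZero-cong (i % c) (λ r≡0 → sym (if-yes (a ≤? i / c) (a≤i/c r≡0))) ⟩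
    ifZero (i % c) (shift a f (i / c))      ∎
    where
    open ≡-Reasoning
    a≤i/c : i % c ≡ 0 → a ≤ i / c
    a≤i/c r≡0 = ℕₚ.*-cancelʳ-≤ a (i / c) c (subst (a *ℕ c ≤_) (trans (ℕ.m≡m%n+[m/n]*n i c) (cong (_+ℕ i / c *ℕ c) r≡0)) ac≤i)
  ... | no ac≰i = trans (if-no (a *ℕ c ≤? i) ac≰i)
                        (sym (trans (ifZero-cong (i % c) (λ r≡0 → if-no (a ≤? i / c) (a≰i/c r≡0))) (ifZero-0ℤ (i % c))))
    where
    a≰i/c : i % c ≡ 0 → ¬ a ≤ i / c
    a≰i/c r≡0 a≤i/c = ac≰i (subst (a *ℕ c ≤_) (sym (trans (ℕ.m≡m%n+[m/n]*n i c) (cong (_+ℕ i / c *ℕ c) r≡0))) (ℕₚ.*-monoˡ-≤ c a≤i/c))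

  oneMinusQ-⊛-dilate-partsLESeries : ∀ k → oneMinusQ (suc k *ℕ c) ⊛ dilate c (partsLESeries (suc k)) ≗ dilate c (partsLESeries k)
  oneMinusQ-⊛-dilate-partsLESeries k i = begin
    (oneMinusQ (suc k *ℕ c) ⊛ D) i          ≡⟨ oneMinusQ-⊛ (suc k *ℕ c) D i ⟩
    D i - shift (suc k *ℕ c) D i            ≡⟨ cong (λ z → D i - z) (dilate-shift (suc k) P i) ⟩
    D i - dilate c (shift (suc k) P) i      ≡⟨ dilate--ₛ P (shift (suc k) P) i ⟨
    dilate c (P -ₛ shift (suc k) P) i       ≡⟨ dilate-cong (partsLESeries-suc k) i ⟩
    dilate c (partsLESeries k) i            ∎
    where
    open ≡-Reasoning
    P = partsLESeries (suc k)
    D = dilate c P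

  prodTrunc-⊛-dilate-partsLESeries : ∀ M → prodTrunc c 1 M ⊛ dilate c (partsLESeries M) ≗ oneS
  prodTrunc-⊛-dilate-partsLESeries zero i = begin
    (oneS ⊛ dilate c (partsLESeries 0)) i   ≡⟨ ⊛-identityˡ (dilate c (partsLESeries 0)) i ⟩
    dilate c (partsLESeries 0) i            ≡⟨ dilate-cong partsLESeries-zero i ⟩
    dilate c oneS i                         ≡⟨ dilate-oneS i ⟩
    oneS i                                  ∎
    where open ≡-Reasoning
  prodTrunc-⊛-dilate-partsLESeries (suc M) i = begin
    ((prodTrunc c 1 M ⊛ powS f 1) ⊛ D) i    ≡⟨ ⊛-assoc (prodTrunc c 1 M) (powS f 1) D i ⟩
    (prodTrunc c 1 M ⊛ (powS f 1 ⊛ D)) i    ≡⟨ ⊛-cong {prodTrunc c 1 M} ≗.refl (⊛-cong {g = D} (⊛-identityʳ f) ≗.refl) i ⟩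
    (prodTrunc c 1 M ⊛ (f ⊛ D)) i           ≡⟨ ⊛-cong {prodTrunc c 1 M} ≗.refl (⊛-cong {f} {g = D} f≗ ≗.refl) i ⟩
    (prodTrunc c 1 M ⊛ (oneMinusQ (suc M *ℕ c) ⊛ D)) i
      ≡⟨ ⊛-cong {prodTrunc c 1 M} ≗.refl (oneMinusQ-⊛-dilate-partsLESeries M) i ⟩
    (prodTrunc c 1 M ⊛ dilate c (partsLESeries M)) i ≡⟨ prodTrunc-⊛-dilate-partsLESeries M i ⟩
    oneS i                                  ∎
    where
    open ≡-Reasoning
    f = oneMinusQ (c *ℕ suc M)
    D = dilate c (partsLESeries (suc M))
    f≗ : f ≗ oneMinusQ (suc M *ℕ c)
    f≗ j = cong (λ b → oneMinusQ b j) (ℕₚ.*-comm c (suc M))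

euler : ∀ c .{{_ : NonZero c}} → prodCoeff c 1 ⊛ dilate c (λ m → + p m) ≗ oneS
euler c i = trans (⊛-agree i coeffs partitions i ℕₚ.≤-refl) (prodTrunc-⊛-dilate-partsLESeries c i i)
  where
  coeffs : AgreeUpTo i (prodCoeff c 1) (prodTrunc c 1 i)
  coeffs j j≤i = sym (prodTrunc-agreeUpTo 1 i (ℕ.>-nonZero⁻¹ c) j j≤i)
  partitions : AgreeUpTo i (dilate c (λ m → + p m)) (dilate c (partsLESeries i))
  partitions j j≤i = cong (ifZero (j % c)) (cong +_ (sym (partsLE-stable (ℕₚ.≤⇒≤′ (ℕₚ.≤-trans (ℕ.m/n≤m j c) j≤i)))))

pThirdSeries : Series
pThirdSeries i = pThird (+ i)

pThirdSeries≗dilate : pThirdSeries ≗ dilate 3 (λ m → + p m)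
-- (+ i) ℤ./ (+ 3) unfolds to + 1 * + (i / 3).
pThirdSeries≗dilate i = bridge (i % 3) (ℤₚ.*-identityˡ (+ (i / 3)))
  where
  bridge : ∀ r {x m} → x ≡ + m → (if does (r ℕ.≟ 0) then pℤ x else 0ℤ) ≡ ifZero r (+ p m)
  bridge zero    refl = refl
  bridge (suc r) _    = refl

prodCoeff-⊛-pThirdSeries : prodCoeff 3 1 ⊛ pThirdSeries ≗ oneS
prodCoeff-⊛-pThirdSeries = ≗.trans (⊛-cong {prodCoeff 3 1} ≗.refl pThirdSeries≗dilate) (euler 3)

pThird-neg : ∀ n → pThird -[1+ n ] ≡ 0ℤ
pThird-neg n = trans (cong (λ u → if does ((-[1+ n ] ℤ.% + 3) ℕ.≟ 0) then u else 0ℤ) quotient-neg) (if-eta _)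
  where
  quotient-neg : pℤ (-[1+ n ] ℤ./ + 3) ≡ 0ℤ
  quotient-neg with -[1+ n ] ℤ./ + 3 | ℤ.a≡a%n+[a/n]*n -[1+ n ] (+ 3)
  ... | + m      | eq = ⊥-elim (-[1+n]≢+ (trans eq (trans (cong (λ z → + (-[1+ n ] ℤ.% + 3) + z) (sym (ℤₚ.pos-* m 3)))
                                                            (sym (ℤₚ.pos-+ _ (m *ℕ 3))))))
    where
    -[1+n]≢+ : ∀ {x} → -[1+ n ] ≢ + x
    -[1+n]≢+ ()
  ... | -[1+ _ ] | _  = refl

+m-+n≡+[m∸n] : ∀ {N i} → i ≤ N → + N - + i ≡ + (N ∸ i)
+m-+n≡+[m∸n] {N} {i} i≤N = trans (ℤₚ.m-n≡m⊖n N i) (ℤₚ.⊖-≥ i≤N)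

pThird[+m-+n]≡0 : ∀ N i → N < i → pThird (+ N - + i) ≡ 0ℤ
pThird[+m-+n]≡0 N i N<i = trans (cong pThird N-i≡-[1+i-1-N]) (pThird-neg (i ∸ suc N))
  where
  N-i≡-[1+i-1-N] : + N - + i ≡ -[1+ i ∸ suc N ]
  N-i≡-[1+i-1-N] = trans (ℤₚ.m-n≡m⊖n N i) (trans (ℤₚ.⊖-< N<i) (cong (λ z → - + z) (ℕₚ.+-∸-assoc 1 N<i)))

⊛-pThirdSeries : ∀ d .{{_ : NonZero d}} N M {f} → N ≤ M → OnMultiples d f →
  (f ⊛ pThirdSeries) N ≡ f 0 * pThird (+ N) + sumFrom1 M (λ j → f (d *ℕ j) * pThird (+ N - + (d *ℕ j)))
⊛-pThirdSeries (suc d) N M {f} N≤M f-on = begin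
  sumTo N (λ i → f i * pThird (+ (N ∸ i)))  ≡⟨ sumTo-cong N (λ i i≤N → cong (λ z → f i * pThird z) (sym (+m-+n≡+[m∸n] i≤N))) ⟩
  sumTo N F                                  ≡⟨ sumTo-onMultiples d N M F N≤M F-on F-vanishes ⟩
  F 0 + sumFrom1 M (λ j → F (suc d *ℕ j))   ≡⟨ cong (λ z → f 0 * pThird z + sumFrom1 M (λ j → F (suc d *ℕ j))) (ℤₚ.+-identityʳ (+ N)) ⟩
  f 0 * pThird (+ N) + sumFrom1 M (λ j → F (suc d *ℕ j)) ∎
  where
  open ≡-Reasoning
  F : Series
  F i = f i * pThird (+ N - + i)
  F-on : OnMultiples (suc d) F
  F-on i d∤i = cong (_* pThird (+ N - + i)) (f-on i d∤i)
  F-vanishes : ∀ i → N < i → F i ≡ 0ℤ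
  F-vanishes i N<i = trans (cong (λ z → f i * z) (pThird[+m-+n]≡0 N i N<i)) (ℤₚ.*-zeroʳ (f i))

-- x stands for n - (9^s - 1)/8.
rhs : ℕ → ℕ → ℤ → ℤ
rhs s n x = pThird x + sumFrom1 n (λ j → r s j * pThird (x - + (3 *ℕ 9 ^ s *ℕ j)))

rhs-coeff : ∀ s n N → N ≤ n → (prodCoeff (3 *ℕ 9 ^ s) 1 ⊛ pThirdSeries) N ≡ rhs s n (+ N)
rhs-coeff s n N N≤n =
  trans (⊛-pThirdSeries (3 *ℕ 9 ^ s) {{d≢0}} N n N≤n (prodCoeff-onMultiples (3 *ℕ 9 ^ s) 1))
        (cong (_+ sumFrom1 n (λ j → r s j * pThird (+ N - + (3 *ℕ 9 ^ s *ℕ j)))) (ℤₚ.*-identityˡ (pThird (+ N))))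
  where
  d≢0 : NonZero (3 *ℕ 9 ^ s)
  d≢0 = ℕₚ.m*n≢0 3 (9 ^ s) {{_}} {{ℕₚ.m^n≢0 9 s}}

rhs-neg : ∀ s n {N K} → N < K → rhs s n (+ N - + K) ≡ 0ℤ
rhs-neg s n {N} {K} N<K = cong₂ _+_ (pThird[+m-+n]≡0 N K N<K) (sumFrom1-zeros n (λ j _ _ →
  trans (cong (r s j *_) (term≡0 (3 *ℕ 9 ^ s *ℕ j))) (ℤₚ.*-zeroʳ (r s j))))
  where
  minus-minus : ∀ a b c → a - b - c ≡ a - (b + c)
  minus-minus = solve-∀
  term≡0 : ∀ x → pThird (+ N - + K - + x) ≡ 0ℤ
  term≡0 x = trans (cong pThird (trans (minus-minus (+ N) (+ K) (+ x)) (cong (λ z → + N - z) (sym (ℤₚ.pos-+ K x)))))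
                   (pThird[+m-+n]≡0 N (K +ℕ x) (ℕₚ.<-≤-trans N<K (ℕₚ.m≤m+n K x)))

9^s≡1+8c : ∀ s → ∃[ c ] 9 ^ s ≡ 1 +ℕ 8 *ℕ c
9^s≡1+8c zero    = 0 , refl
9^s≡1+8c (suc s) with 9^s≡1+8c s
... | c , eq = 9 *ℕ c +ℕ 1 , trans (cong (9 *ℕ_) eq) (expand c)
  where
  expand : ∀ c → 9 *ℕ (1 +ℕ 8 *ℕ c) ≡ 1 +ℕ 8 *ℕ (9 *ℕ c +ℕ 1)
  expand = ℕ-Solver.solve-∀

9^s≡1+8*kS : ∀ s → 9 ^ s ≡ 1 +ℕ 8 *ℕ kS s
9^s≡1+8*kS s with 9^s≡1+8c s
... | c , eq = trans eq (cong (λ x → 1 +ℕ 8 *ℕ x) (sym kS≡c))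
  where
  kS≡c : kS s ≡ c
  kS≡c = trans (cong (λ x → (x ∸ 1) / 8) eq) (trans (cong (_/ 8) (ℕₚ.*-comm 8 c)) (ℕ.m*n/n≡m c 8))

24*kS+3≡3^[1+2s] : ∀ s → 24 *ℕ kS s +ℕ 3 ≡ 3 ^ suc (2 *ℕ s)
24*kS+3≡3^[1+2s] s = begin
  24 *ℕ kS s +ℕ 3        ≡⟨ regroup (kS s) ⟩
  3 *ℕ (1 +ℕ 8 *ℕ kS s)  ≡⟨ cong (3 *ℕ_) (9^s≡1+8*kS s) ⟨
  3 *ℕ 9 ^ s             ≡⟨ cong (3 *ℕ_) (ℕₚ.^-*-assoc 3 2 s) ⟩
  3 ^ suc (2 *ℕ s)       ∎
  where
  open ≡-Reasoning
  regroup : ∀ k → 24 *ℕ k +ℕ 3 ≡ 3 *ℕ (1 +ℕ 8 *ℕ k)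
  regroup = ℕ-Solver.solve-∀

prodCoeff-⊛-prodCoeff : ∀ {e t} → e +ℕ 3 ≡ 3 ^ t → ∀ c → 1 ≤ c →
  prodCoeff c e ⊛ prodCoeff (3 *ℕ c) 1 ≋ₛ prodCoeff (3 ^ t *ℕ c) 1
prodCoeff-⊛-prodCoeff {e} {t} e+3≡3^t c 1≤c i = ≋-trans
  (≋-reflexive (⊛-agree i (≗-upTo (prodTrunc-agreeUpTo e i 1≤c)) (≗-upTo (prodTrunc-agreeUpTo 1 i 1≤3c)) i ℕₚ.≤-refl))
  (prodTrunc-⊛-prodTrunc {e} {t} e+3≡3^t c i i)
  where
  1≤3c = ℕₚ.≤-trans 1≤c (ℕₚ.m≤n*m c 3)
  ≗-upTo : ∀ {f g} → AgreeUpTo i f g → AgreeUpTo i g f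
  ≗-upTo f≡g j j≤i = sym (f≡g j j≤i)

Δ^kS-congruence : ∀ s → prodCoeff 1 (24 *ℕ kS s) ≋ₛ prodCoeff (3 *ℕ 9 ^ s) 1 ⊛ pThirdSeries
Δ^kS-congruence s = begin
  A                                        ≈⟨ ≗⇒≋ₛ (⊛-identityʳ A) ⟨
  A ⊛ oneS                                 ≈⟨ ≗⇒≋ₛ (⊛-cong {A} ≗.refl prodCoeff-⊛-pThirdSeries) ⟨
  A ⊛ (prodCoeff 3 1 ⊛ pThirdSeries)       ≈⟨ ≗⇒≋ₛ (⊛-assoc A (prodCoeff 3 1) pThirdSeries) ⟨
  (A ⊛ prodCoeff 3 1) ⊛ pThirdSeries
    ≈⟨ ⊛-cong-≋ₛ {A ⊛ prodCoeff 3 1} {g = pThirdSeries} {g′ = pThirdSeries} (prodCoeff-⊛-prodCoeff {t = suc (2 *ℕ s)} (24*kS+3≡3^[1+2s] s) 1 ℕₚ.≤-refl) (≗⇒≋ₛ ≗.refl) ⟩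
  prodCoeff (3 ^ suc (2 *ℕ s) *ℕ 1) 1 ⊛ pThirdSeries
    ≡⟨ cong (λ d → prodCoeff d 1 ⊛ pThirdSeries) (trans (ℕₚ.*-identityʳ (3 ^ suc (2 *ℕ s))) (cong (3 *ℕ_) (sym (ℕₚ.^-*-assoc 3 2 s)))) ⟩
  prodCoeff (3 *ℕ 9 ^ s) 1 ⊛ pThirdSeries ∎
  where
  open SetoidReasoning ≋ₛ-setoid
  A = prodCoeff 1 (24 *ℕ kS s)

-- The congruence also holds for s = 0.
lemma3p2 : (s : ℕ) → 1 ≤ s → (n : ℕ) →
    a s n ≡₃ (pThird (+ n - + kS s)
    + sumFrom1 n (λ j → r s j * pThird (+ n - + kS s - + (3 *ℕ 9 ^ s *ℕ j))))
lemma3p2 s _ n with kS s ≤? n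
... | yes k≤n = ∣⇒∣ᵤ (m∣x-y (begin
  a s n                                                    ≡⟨ if-yes (kS s ≤? n) k≤n ⟩
  prodCoeff 1 (24 *ℕ kS s) N                               ≈⟨ Δ^kS-congruence s N ⟩
  (prodCoeff (3 *ℕ 9 ^ s) 1 ⊛ pThirdSeries) N              ≡⟨ rhs-coeff s n N (ℕₚ.m∸n≤m n (kS s)) ⟩
  rhs s n (+ N)                                            ≡⟨ cong (rhs s n) (+m-+n≡+[m∸n] k≤n) ⟨
  rhs s n (+ n - + kS s)                                   ∎))
  where
  open SetoidReasoning ≋-setoid
  N = n ∸ kS s
... | no k≰n = ∣⇒∣ᵤ (m∣x-y (≋-reflexive (trans (if-no (kS s ≤? n) k≰n) (sym (rhs-neg s n (ℕₚ.≰⇒> k≰n))))))
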